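{- Let $\mu$ be a nonempty partition. If there exists a positive integer $i$ such that $\mu^r_i>i+1$, then the largest such integer is $d(\mu)-1$; in other words, the set of positive integers $i$ with $\mu^r_i>i+1$ equals the set of positive integers $i$ with $i\le d(\mu)-1$.
   Context: For a partition $\lambda$ set $\lambda_t=0$ for $t>\ell(\lambda)$; $d(\lambda)$ is the largest $i\ge1$ with $\lambda_i\ge i$ (length of the diagonal). The Maya diagram of $\lambda$ is $S(\lambda)=\{\lambda_t-t+\tfrac12:t\ge1\}$. For $S\subseteq\mathbb{Z}+\tfrac12$ let $S^+=\{x\in S:x>0\}$, $S^-=\{x\in(\mathbb{Z}+\tfrac12)\setminus S:x<0\}$; if finite, $c(S)=|S^+|-|S^-|$ and $\{s-c(S):s\in S\}$ is the Maya diagram of a unique partition, the partition associated to $S$. For nonempty $\mu$ with $S=S(\mu)$, $\mu^r$ is the partition associated to $S\setminus\{\min S^+\}$. -}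

module Defs where

open import Data.Nat as ℕ using (ℕ; zero; suc; _≤_; _<_; _≥_; _∸_)
open import Data.Integer as ℤ using (ℤ; +_; _-_)
open import Data.List using (List; []; _∷_; length)
open import Data.List.Relation.Unary.All using (All)
open import Data.List.Relation.Unary.Linked using (Linked)
open import Data.List.Relation.Unary.Unique.Propositional using (Unique)
open import Data.List.Membership.Propositional using (_∈_)
open import Data.Product using (Σ; ∃; _×_)
open import Function.Bundles using (_⇔_)
open import Relation.Binary.PropositionalEquality using (_≡_; _≢_)

record Partition : Set where
  constructor mkPartition
  field
    parts      : List ℕ
    decreasing : Linked _≥_ parts
    positive   : All (0 <_) parts
open Partition public

nth : List ℕ → ℕ → ℕ
nth []       _       = 0
nth (x ∷ xs) zero    = x
nth (x ∷ xs) (suc n) = nth xs n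

-- λ_t for t ≥ 1 (λ_t = 0 for t > ℓ(λ)); only meaningful for t ≥ 1
part : Partition → ℕ → ℕ
part λ' t = nth (parts λ') (t ∸ 1)

Nonempty : Partition → Set
Nonempty λ' = 1 ≤ length (parts λ')

IsDiagonalLength : Partition → ℕ → Set
IsDiagonalLength λ' d =
  1 ≤ d × d ≤ part λ' d × (∀ i → 1 ≤ i → i ≤ part λ' i → i ≤ d)

-- Subsets of ℤ + 1/2, encoded: the integer k stands for k + 1/2.
HalfIntSet : Set₁
HalfIntSet = ℤ → Set

Maya : Partition → HalfIntSet
Maya λ' k = Σ ℕ (λ t → 1 ≤ t × (+ part λ' t - + t ≡ k))

-- S⁺ = {x ∈ S : x > 0}  (k + 1/2 > 0  ⇔  k ≥ 0)
Pos : HalfIntSet → HalfIntSet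
Pos S k = S k × + 0 ℤ.≤ k

-- S⁻ = {x ∉ S : x < 0}  (k + 1/2 < 0  ⇔  k < 0)
Neg : HalfIntSet → HalfIntSet
Neg S k = (S k → Data.Empty.⊥) × k ℤ.< + 0
  where import Data.Empty

HasCard : HalfIntSet → ℕ → Set
HasCard P n = Σ (List ℤ) (λ L → Unique L × (∀ x → (x ∈ L) ⇔ P x) × length L ≡ n)

IsCharge : HalfIntSet → ℤ → Set
IsCharge S c = Σ ℕ (λ p → Σ ℕ (λ q →
  HasCard (Pos S) p × HasCard (Neg S) q × c ≡ + p - + q))

IsAssociated : HalfIntSet → Partition → Set
IsAssociated S ν = Σ ℤ (λ c → IsCharge S c ×
  (∀ k → Maya ν k ⇔ Σ ℤ (λ s → S s × k ≡ s - c)))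

IsMinPos : HalfIntSet → ℤ → Set
IsMinPos S m = Pos S m × (∀ x → Pos S x → m ℤ.≤ x)

IsMuR : Partition → Partition → Set
IsMuR μ ν = Σ ℤ (λ m → IsMinPos (Maya μ) m ×
  IsAssociated (λ k → Maya μ k × k ≢ m) ν)

-- Reading the Maya diagram of a partition as the strictly decreasing sequence
-- k ↦ λ_k − k, the minimal positive element of S(μ) sits at position d = d(μ).
-- Deleting it leaves the sequence of S(μ) with position d skipped, and the charge
-- of the remaining set is −1, so that S(μ^r) is this sequence shifted up by one:
-- μ^r_i = μ_i + 1 for i < d and μ^r_i = μ_{i+1} for i ≥ d.  Since μ_i ≥ i exactly
-- for i ≤ d, the inequality μ^r_i > i + 1 holds exactly for i ≤ d − 1.
module Submission where

open import Defs
open import Data.Nat using (ℕ; _≤_; _<_; _+_; _∸_)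
open import Function.Bundles using (_⇔_)

open import Data.Nat using (zero; suc; z≤n; s≤s; _≤′_; ≤′-reflexive; ≤′-step; _≥_; _<?_)
import Data.Nat.Properties as ℕₚ
open import Data.Integer as ℤ using (ℤ; +_; -[1+_]; _-_; +≤+; +<+)
import Data.Integer.Properties as ℤₚ
open import Data.Integer.Tactic.RingSolver using (solve-∀)
open import Data.List using (List; []; _∷_; length)
open import Data.List.Relation.Unary.Linked using (Linked; []; [-]; _∷_)
open import Data.Product using (_×_; _,_; ∃-syntax)
open import Data.Sum using (inj₁; inj₂)
open import Data.Empty using (⊥-elim)
open import Function.Base using (_∘_)
open import Function.Bundles using (mk⇔; Equivalence)
open import Relation.Nullary using (yes; no)
open import Relation.Binary using (tri<; tri≈; tri>)
open import Relation.Binary.PropositionalEquality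

-≡-⇒+≡+ : ∀ {w x y z : ℤ} → w - x ≡ y - z → w ℤ.+ z ≡ y ℤ.+ x
-≡-⇒+≡+ {w} {x} {y} {z} eq = begin
  w ℤ.+ z                 ≡⟨ unfold w x z ⟩
  (w - x) ℤ.+ (x ℤ.+ z)   ≡⟨ cong (ℤ._+ (x ℤ.+ z)) eq ⟩
  (y - z) ℤ.+ (x ℤ.+ z)   ≡⟨ fold y z x ⟩
  y ℤ.+ x                 ∎
  where
  open ≡-Reasoning
  unfold : ∀ w x z → w ℤ.+ z ≡ (w - x) ℤ.+ (x ℤ.+ z)
  unfold = solve-∀
  fold : ∀ y z x → (y - z) ℤ.+ (x ℤ.+ z) ≡ y ℤ.+ x
  fold = solve-∀

nth-suc-≤ : ∀ {xs} → Linked _≥_ xs → ∀ n → nth xs (suc n) ≤ nth xs n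
nth-suc-≤ []         n       = z≤n
nth-suc-≤ [-]        n       = z≤n
nth-suc-≤ (x≥y ∷ xs) zero    = x≥y
nth-suc-≤ (x≥y ∷ xs) (suc n) = nth-suc-≤ xs n

nth-antitone′ : ∀ {xs} → Linked _≥_ xs → ∀ {j k} → j ≤′ k → nth xs k ≤ nth xs j
nth-antitone′ xs (≤′-reflexive refl) = ℕₚ.≤-refl
nth-antitone′ xs (≤′-step {k} j≤′k) = ℕₚ.≤-trans (nth-suc-≤ xs k) (nth-antitone′ xs j≤′k)

nth-antitone : ∀ {xs} → Linked _≥_ xs → ∀ {j k} → j ≤ k → nth xs k ≤ nth xs j
nth-antitone xs = nth-antitone′ xs ∘ ℕₚ.≤⇒≤′

nth-beyond : ∀ (xs : List ℕ) {n} → length xs ≤ n → nth xs n ≡ 0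
nth-beyond []       _               = refl
nth-beyond (x ∷ xs) (s≤s len≤n) = nth-beyond xs len≤n

part-antitone : ∀ λ' {i j} → i ≤ j → part λ' j ≤ part λ' i
part-antitone λ' i≤j = nth-antitone (decreasing λ') (ℕₚ.∸-monoˡ-≤ 1 i≤j)

≤part⇔≤diagonal : ∀ {λ' d} → IsDiagonalLength λ' d →
  ∀ {i} → 1 ≤ i → (i ≤ part λ' i) ⇔ (i ≤ d)
≤part⇔≤diagonal {λ'} (_ , d≤λd , maximal) 1≤i =
  mk⇔ (maximal _ 1≤i) (λ i≤d → ℕₚ.≤-trans i≤d (ℕₚ.≤-trans d≤λd (part-antitone λ' i≤d)))

StrictlyDecreasing : (ℕ → ℤ) → Set
StrictlyDecreasing f = ∀ n → f (suc n) ℤ.< f n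

module _ {f : ℕ → ℤ} (f↓ : StrictlyDecreasing f) where

  strictlyDecreasing-<′ : ∀ {j k} → suc j ≤′ k → f k ℤ.< f j
  strictlyDecreasing-<′ (≤′-reflexive refl) = f↓ _
  strictlyDecreasing-<′ (≤′-step {k} j<′k) = ℤₚ.<-trans (f↓ k) (strictlyDecreasing-<′ j<′k)

  strictlyDecreasing-< : ∀ {j k} → j < k → f k ℤ.< f j
  strictlyDecreasing-< = strictlyDecreasing-<′ ∘ ℕₚ.≤⇒≤′

  strictlyDecreasing-≤ : ∀ {j k} → j ≤ k → f k ℤ.≤ f j
  strictlyDecreasing-≤ j≤k with ℕₚ.m≤n⇒m<n∨m≡n j≤k
  ... | inj₁ j<k  = ℤₚ.<⇒≤ (strictlyDecreasing-< j<k)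
  ... | inj₂ refl = ℤₚ.≤-refl

  strictlyDecreasing-injective : ∀ {j k} → f j ≡ f k → j ≡ k
  strictlyDecreasing-injective {j} {k} fj≡fk with ℕₚ.<-cmp j k
  ... | tri< j<k _ _ = ⊥-elim (ℤₚ.<-irrefl (sym fj≡fk) (strictlyDecreasing-< j<k))
  ... | tri≈ _ j≡k _ = j≡k
  ... | tri> _ _ k<j = ⊥-elim (ℤₚ.<-irrefl fj≡fk (strictlyDecreasing-< k<j))

agreeBelow⇒≤ : ∀ {f g} → StrictlyDecreasing f → StrictlyDecreasing g →
  ∀ n → (∀ k → k < n → f k ≡ g k) → ∃[ j ] f n ≡ g j → f n ℤ.≤ g n
agreeBelow⇒≤ {f} {g} f↓ g↓ n agree (j , fn≡gj) with n ℕₚ.≤? j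
... | yes n≤j = subst (ℤ._≤ g n) (sym fn≡gj) (strictlyDecreasing-≤ g↓ n≤j)
... | no  n≰j = ⊥-elim (ℤₚ.<-irrefl (trans fn≡gj (sym (agree j j<n))) (strictlyDecreasing-< f↓ j<n))
  where j<n = ℕₚ.≰⇒> n≰j

strictlyDecreasing-sameImage⇒≗ : ∀ {f g} → StrictlyDecreasing f → StrictlyDecreasing g →
  (∀ n → ∃[ j ] f n ≡ g j) → (∀ n → ∃[ j ] g n ≡ f j) → f ≗ g
strictlyDecreasing-sameImage⇒≗ {f} {g} f↓ g↓ f⊆g g⊆f n = agreeBelow (suc n) n ℕₚ.≤-refl
  where
  agreeBelow : ∀ n k → k < n → f k ≡ g k
  agreeBelow (suc n) k k<1+n with ℕₚ.m≤n⇒m<n∨m≡n (ℕₚ.≤-pred k<1+n)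
  ... | inj₁ k<n  = agreeBelow n k k<n
  ... | inj₂ refl = ℤₚ.≤-antisym
    (agreeBelow⇒≤ f↓ g↓ k (agreeBelow k) (f⊆g k))
    (agreeBelow⇒≤ g↓ f↓ k (λ i i<k → sym (agreeBelow k i i<k)) (g⊆f k))

Enumerates : (ℕ → ℤ) → HalfIntSet → Set
Enumerates f S = ∀ k → S k ⇔ (∃[ j ] f j ≡ k)

-- The order-preserving enumeration of ℕ ∖ {d}.
punchIn : ℕ → ℕ → ℕ
punchIn zero    n       = suc n
punchIn (suc d) zero    = zero
punchIn (suc d) (suc n) = suc (punchIn d n)

punchIn-< : ∀ d n → punchIn d n < punchIn d (suc n)
punchIn-< zero    n       = ℕₚ.≤-refl
punchIn-< (suc d) zero    = s≤s z≤n
punchIn-< (suc d) (suc n) = s≤s (punchIn-< d n)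

punchIn≢ : ∀ d n → punchIn d n ≢ d
punchIn≢ zero    n       ()
punchIn≢ (suc d) zero    ()
punchIn≢ (suc d) (suc n) eq = punchIn≢ d n (ℕₚ.suc-injective eq)

punchIn-surjective : ∀ d j → j ≢ d → ∃[ n ] punchIn d n ≡ j
punchIn-surjective zero    zero    j≢d = ⊥-elim (j≢d refl)
punchIn-surjective zero    (suc j) _   = j , refl
punchIn-surjective (suc d) zero    _   = zero , refl
punchIn-surjective (suc d) (suc j) j≢d with punchIn-surjective d j (j≢d ∘ cong suc)
... | n , eq = suc n , cong suc eq

punchIn-below : ∀ {d n} → n < d → punchIn d n ≡ n
punchIn-below {suc d} {zero}  _         = refl
punchIn-below {suc d} {suc n} (s≤s n<d) = cong suc (punchIn-below n<d)

punchIn-above : ∀ {d n} → d ≤ n → punchIn d n ≡ suc n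
punchIn-above {zero}  _         = refl
punchIn-above {suc d} (s≤s d≤n) = cong suc (punchIn-above d≤n)

module _ {f : ℕ → ℤ} (f↓ : StrictlyDecreasing f) where

  strictlyDecreasing-punchIn : ∀ d → StrictlyDecreasing (f ∘ punchIn d)
  strictlyDecreasing-punchIn d n = strictlyDecreasing-< f↓ (punchIn-< d n)

  enumerates-punchIn : ∀ {S} → Enumerates f S → ∀ d →
    Enumerates (f ∘ punchIn d) (λ k → S k × k ≢ f d)
  enumerates-punchIn {S} f↠S d k = mk⇔ to from
    where
    to : S k × k ≢ f d → ∃[ n ] f (punchIn d n) ≡ k
    to (Sk , k≢fd) with Equivalence.to (f↠S k) Sk
    ... | j , fj≡k with punchIn-surjective d j (λ j≡d → k≢fd (trans (sym fj≡k) (cong f j≡d)))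
    ... | n , eq = n , trans (cong f eq) fj≡k
    from : ∃[ n ] f (punchIn d n) ≡ k → S k × k ≢ f d
    from (n , eq) = Equivalence.from (f↠S k) (punchIn d n , eq)
                  , λ k≡fd → punchIn≢ d n (strictlyDecreasing-injective f↓ (trans eq k≡fd))

-- Indexed from 0: mayaSeq λ n encodes λ_{n+1} − (n+1) + 1/2.
mayaSeq : Partition → ℕ → ℤ
mayaSeq λ' n = + part λ' (suc n) - + suc n

mayaSeq-strictlyDecreasing : ∀ λ' → StrictlyDecreasing (mayaSeq λ')
mayaSeq-strictlyDecreasing λ' n =
  ℤₚ.+-mono-≤-< (+≤+ (nth-suc-≤ (decreasing λ') n)) (ℤₚ.neg-mono-< (+<+ (ℕₚ.n<1+n (suc n))))

mayaSeq-enumerates : ∀ λ' → Enumerates (mayaSeq λ') (Maya λ')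
mayaSeq-enumerates λ' k =
  mk⇔ (λ { (suc n , _ , eq) → n , eq }) (λ (n , eq) → suc n , s≤s z≤n , eq)

0≤mayaSeq⇔ : ∀ λ' n → (+ 0 ℤ.≤ mayaSeq λ' n) ⇔ (suc n ≤ part λ' (suc n))
0≤mayaSeq⇔ λ' n = mk⇔ (ℤₚ.drop‿+≤+ ∘ ℤₚ.0≤i-j⇒j≤i) (ℤₚ.i≤j⇒0≤j-i ∘ +≤+)

minPos-Maya≡mayaSeq-diag : ∀ λ' {d m} → IsDiagonalLength λ' (suc d) → IsMinPos (Maya λ') m →
  m ≡ mayaSeq λ' d
minPos-Maya≡mayaSeq-diag λ' {d} diag@(_ , d≤λd , _) ((Maya-m , 0≤m) , minimal)
  with Equivalence.to (mayaSeq-enumerates λ' _) Maya-m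
... | n , refl = ℤₚ.≤-antisym (minimal (mayaSeq λ' d) diag∈S⁺)
                              (strictlyDecreasing-≤ (mayaSeq-strictlyDecreasing λ') n≤d)
  where
  diag∈S⁺ : Pos (Maya λ') (mayaSeq λ' d)
  diag∈S⁺ = Equivalence.from (mayaSeq-enumerates λ' _) (d , refl)
          , Equivalence.from (0≤mayaSeq⇔ λ' d) d≤λd
  n≤d : n ≤ d
  n≤d = ℕₚ.≤-pred (Equivalence.to (≤part⇔≤diagonal {λ'} diag (s≤s z≤n))
                                  (Equivalence.to (0≤mayaSeq⇔ λ' n) 0≤m))

associated-mayaSeq : ∀ {f S ν c} → StrictlyDecreasing f → Enumerates f S →
  (∀ k → Maya ν k ⇔ (∃[ s ] S s × k ≡ s - c)) → mayaSeq ν ≗ λ n → f n - c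
associated-mayaSeq {f} {ν = ν} {c} f↓ f↠S shift =
  strictlyDecreasing-sameImage⇒≗ (mayaSeq-strictlyDecreasing ν)
    (λ n → ℤₚ.+-monoˡ-< (ℤ.- c) (f↓ n)) ν⊆f f⊆ν
  where
  ν⊆f : ∀ n → ∃[ j ] mayaSeq ν n ≡ f j - c
  ν⊆f n with Equivalence.to (shift _) (Equivalence.from (mayaSeq-enumerates ν _) (n , refl))
  ... | s , Ss , eq with Equivalence.to (f↠S s) Ss
  ... | j , refl = j , eq
  f⊆ν : ∀ j → ∃[ n ] f j - c ≡ mayaSeq ν n
  f⊆ν j with Equivalence.to (mayaSeq-enumerates ν _)
               (Equivalence.from (shift _) (f j , Equivalence.from (f↠S _) (j , refl) , refl))
  ... | n , eq = n , sym eq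

mayaSeq≡mayaSeq+1⇒ : ∀ {ν μ n k} → mayaSeq ν n ≡ mayaSeq μ k ℤ.+ + 1 →
  part ν (suc n) + suc k ≡ suc (part μ (suc k)) + suc n
mayaSeq≡mayaSeq+1⇒ {ν} {μ} {n} {k} eq =
  ℤₚ.+-injective (-≡-⇒+≡+ {+ part ν (suc n)} {+ suc n} {+ suc (part μ (suc k))} {+ suc k}
    (trans eq (absorb (+ part μ (suc k)) (+ suc k))))
  where
  absorb : ∀ x y → (x - y) ℤ.+ + 1 ≡ (+ 1 ℤ.+ x) - y
  absorb = solve-∀

-- Far enough out both Maya diagrams are the consecutive negative half-integers,
-- which forces the shift; the charge need not be counted.
punchIn-shift≡-1 : ∀ {μ ν d c} → mayaSeq ν ≗ (λ n → mayaSeq μ (punchIn d n) - c) → c ≡ -[1+ 0 ]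
punchIn-shift≡-1 {μ} {ν} {d} {c} ν≗ = begin
  c            ≡⟨ recenter c (+ N) ⟩
  y - (y - c)  ≡⟨ cong (y -_) (sym tails) ⟩
  y - x        ≡⟨ gap (+ N) ⟩
  -[1+ 0 ]     ∎
  where
  open ≡-Reasoning
  N : ℕ
  N = length (parts ν) + length (parts μ) + d
  x y : ℤ
  x = + 0 - + suc N
  y = + 0 - + suc (suc N)
  ν-short : length (parts ν) ≤ N
  ν-short = ℕₚ.≤-trans (ℕₚ.m≤m+n _ _) (ℕₚ.m≤m+n _ d)
  μ-short : length (parts μ) ≤ suc N
  μ-short = ℕₚ.m≤n⇒m≤1+n (ℕₚ.≤-trans (ℕₚ.m≤n+m _ (length (parts ν))) (ℕₚ.m≤m+n _ d))
  tails : x ≡ y - c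
  tails = begin
    x                            ≡⟨ cong (λ a → + a - + suc N) (sym (nth-beyond (parts ν) ν-short)) ⟩
    mayaSeq ν N                  ≡⟨ ν≗ N ⟩
    mayaSeq μ (punchIn d N) - c  ≡⟨ cong (λ t → mayaSeq μ t - c) (punchIn-above (ℕₚ.m≤n+m d _)) ⟩
    mayaSeq μ (suc N) - c        ≡⟨ cong (λ a → (+ a - + suc (suc N)) - c) (nth-beyond (parts μ) μ-short) ⟩
    y - c                        ∎
  recenter : ∀ c n → c ≡ (+ 0 - (+ 1 ℤ.+ (+ 1 ℤ.+ n))) - ((+ 0 - (+ 1 ℤ.+ (+ 1 ℤ.+ n))) - c)
  recenter = solve-∀
  gap : ∀ n → (+ 0 - (+ 1 ℤ.+ (+ 1 ℤ.+ n))) - (+ 0 - (+ 1 ℤ.+ n)) ≡ ℤ.- + 1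
  gap = solve-∀

muR-mayaSeq : ∀ μ ν {d} → IsDiagonalLength μ (suc d) → IsMuR μ ν →
  mayaSeq ν ≗ λ n → mayaSeq μ (punchIn d n) ℤ.+ + 1
muR-mayaSeq μ ν {d} diag (m , minPos , c , _ , shift) n = begin
  mayaSeq ν n                        ≡⟨ ν≗ n ⟩
  mayaSeq μ (punchIn d n) - c        ≡⟨ cong (mayaSeq μ (punchIn d n) -_) (punchIn-shift≡-1 {μ} {ν} ν≗) ⟩
  mayaSeq μ (punchIn d n) ℤ.+ + 1    ∎
  where
  open ≡-Reasoning
  μ↓ = mayaSeq-strictlyDecreasing μ
  enum : Enumerates (mayaSeq μ ∘ punchIn d) (λ k → Maya μ k × k ≢ m)
  enum = subst (λ m → Enumerates (mayaSeq μ ∘ punchIn d) (λ k → Maya μ k × k ≢ m))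
               (sym (minPos-Maya≡mayaSeq-diag μ diag minPos))
               (enumerates-punchIn μ↓ (mayaSeq-enumerates μ) d)
  ν≗ : mayaSeq ν ≗ λ n → mayaSeq μ (punchIn d n) - c
  ν≗ = associated-mayaSeq {ν = ν} (strictlyDecreasing-punchIn μ↓ d) enum shift

muR-part-below : ∀ μ ν {d} → IsDiagonalLength μ (suc d) → IsMuR μ ν →
  ∀ {n} → n < d → part ν (suc n) ≡ suc (part μ (suc n))
muR-part-below μ ν diag muR {n} n<d = ℕₚ.+-cancelʳ-≡ (suc n) _ _ (mayaSeq≡mayaSeq+1⇒ {ν} {μ}
  (trans (muR-mayaSeq μ ν diag muR n) (cong (λ k → mayaSeq μ k ℤ.+ + 1) (punchIn-below n<d))))

muR-part-above : ∀ μ ν {d} → IsDiagonalLength μ (suc d) → IsMuR μ ν →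
  ∀ {n} → d ≤ n → part ν (suc n) ≡ part μ (suc (suc n))
muR-part-above μ ν diag muR {n} d≤n = ℕₚ.+-cancelʳ-≡ (suc (suc n)) _ _ (begin
  part ν (suc n) + suc (suc n)           ≡⟨ mayaSeq≡mayaSeq+1⇒ {ν} {μ} (trans (muR-mayaSeq μ ν diag muR n)
                                              (cong (λ k → mayaSeq μ k ℤ.+ + 1) (punchIn-above d≤n))) ⟩
  suc (part μ (suc (suc n))) + suc n     ≡⟨ ℕₚ.+-suc (part μ (suc (suc n))) (suc n) ⟨
  part μ (suc (suc n)) + suc (suc n)     ∎)
  where open ≡-Reasoning

lemma5p16 : (μ : Partition) → Nonempty μ → (d : ℕ) → IsDiagonalLength μ d →
    (ν : Partition) → IsMuR μ ν →
    (i : ℕ) → 1 ≤ i → ((i + 1 < part ν i) ⇔ (i ≤ d ∸ 1))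
lemma5p16 μ _ (suc d) diag ν muR (suc n) _ with n <? d
... | yes n<d = mk⇔ (λ _ → n<d) (λ _ → n+2<νₙ₊₁)
  where
  n+2≤μₙ₊₁ : suc n + 1 ≤ part μ (suc n)
  n+2≤μₙ₊₁ = subst (_≤ part μ (suc n)) (ℕₚ.+-comm 1 (suc n))
    (ℕₚ.≤-trans (Equivalence.from (≤part⇔≤diagonal {μ} diag (s≤s z≤n)) (s≤s n<d))
                (part-antitone μ (ℕₚ.n≤1+n (suc n))))
  n+2<νₙ₊₁ : suc n + 1 < part ν (suc n)
  n+2<νₙ₊₁ = subst (suc n + 1 <_) (sym (muR-part-below μ ν diag muR n<d)) (s≤s n+2≤μₙ₊₁)
... | no  n≮d = mk⇔ n+2<νₙ₊₁⇒n<d (λ n<d → ⊥-elim (n≮d n<d))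
  where
  n+2<νₙ₊₁⇒n<d : suc n + 1 < part ν (suc n) → n < d
  n+2<νₙ₊₁⇒n<d n+2<νₙ₊₁ = ℕₚ.≤-pred (Equivalence.to (≤part⇔≤diagonal {μ} diag (s≤s z≤n))
    (subst₂ _≤_ (ℕₚ.+-comm (suc n) 1) (muR-part-above μ ν diag muR (ℕₚ.≮⇒≥ n≮d)) (ℕₚ.<⇒≤ n+2<νₙ₊₁)))
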